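{- If a tree $T$ has a 2SUIG representation, then every vertex of $T$ has degree at most four.
   Context: Fix a constant $\epsilon\in(0,1)$. A graph $G$ is a 2SUIG (2-stab unit interval graph) if there is an assignment of a closed axis-parallel unit square $s_v$ to each vertex $v$ such that $uv\in E(G)$ iff $u\neq v$ and $s_u\cap s_v\neq\emptyset$, and every square $s_v$ intersects one of the lines $y=1$ (lower stab line) or $y=2+\epsilon$ (upper stab line). Such an assignment is a 2SUIG representation. -}

module Defs where

open import Level using (Level; _⊔_) renaming (suc to lsuc)
open import Algebra.Bundles using (CommutativeRing)
open import Relation.Binary.Core using (Rel)
open import Relation.Binary.Structures using (IsTotalOrder)
open import Relation.Binary.PropositionalEquality using (_≡_)
open import Relation.Nullary using (¬_)
open import Data.Product using (_×_; ∃; Σ)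
open import Data.Sum using (_⊎_)
open import Data.Bool using (Bool; true; false)
open import Data.Nat using (ℕ) renaming (_≤_ to _≤ℕ_)
open import Data.Fin using (Fin)
open import Data.List using (List; []; _∷_; length; filter; allFin; last)
open import Data.Maybe using (just)
open import Data.List.Relation.Unary.Unique.Propositional using (Unique)
open import Data.Bool.Properties using (T?)
open import Data.Bool using (T)
open import Function.Bundles using (_⇔_)

-- Ordered fields (the stdlib has none).  The real numbers are a model;
-- coordinates of the squares are taken in an arbitrary ordered field.

record OrderedField (c ℓ₁ ℓ₂ : Level) : Set (lsuc (c ⊔ ℓ₁ ⊔ ℓ₂)) where
  field
    commutativeRing : CommutativeRing c ℓ₁
  open CommutativeRing commutativeRing public
  infix 4 _≤F_ _<F_
  field
    _≤F_         : Rel Carrier ℓ₂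
    isTotalOrder : IsTotalOrder _≈_ _≤F_
    +-mono-≤F    : ∀ {x y} z → x ≤F y → (x + z) ≤F (y + z)
    *-nonneg     : ∀ {x y} → 0# ≤F x → 0# ≤F y → 0# ≤F (x * y)
    0≉1          : ¬ (0# ≈ 1#)
    inverse      : ∀ x → ¬ (x ≈ 0#) → ∃ λ y → (x * y) ≈ 1#

  _<F_ : Rel Carrier (ℓ₁ ⊔ ℓ₂)
  x <F y = (x ≤F y) × ¬ (x ≈ y)

  2# : Carrier
  2# = 1# + 1#

record Graph (n : ℕ) : Set where
  field
    adj      : Fin n → Fin n → Bool
    symmetric : ∀ u v → adj u v ≡ adj v u
    irreflexive : ∀ v → adj v v ≡ false

open Graph public

Adj : ∀ {n} → Graph n → Fin n → Fin n → Set
Adj G u v = T (adj G u v)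

degree : ∀ {n} → Graph n → Fin n → ℕ
degree {n} G v = length (filter (λ w → T? (adj G v w)) (allFin n))

data Chain {n} (G : Graph n) : List (Fin n) → Set where
  []  : Chain G []
  [-] : ∀ v → Chain G (v ∷ [])
  _∷_ : ∀ {u v vs} → Adj G u v → Chain G (v ∷ vs) → Chain G (u ∷ v ∷ vs)

record Path {n} (G : Graph n) (u v : Fin n) : Set where
  field
    first : Fin n
    rest  : List (Fin n)
    start : first ≡ u
    chain : Chain G (first ∷ rest)
    distinct : Unique (first ∷ rest)
    endsAt : last (first ∷ rest) ≡ just v

record Cycle {n} (G : Graph n) : Set where
  field
    v₀ : Fin n
    vs : List (Fin n)
    long : 2 ≤ℕ length vs
    chain : Chain G (v₀ ∷ vs)
    distinct : Unique (v₀ ∷ vs)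
    closing : ∀ w → last (v₀ ∷ vs) ≡ just w → Adj G w v₀

IsTree : ∀ {n} → Graph n → Set
IsTree {n} G = (∀ (u v : Fin n) → Path G u v) × ¬ Cycle G

-- 2SUIG representations.  A closed axis-parallel unit square is given by
-- its lower-left corner (x , y): it is [x, x+1] × [y, y+1].

module _ {c ℓ₁ ℓ₂} (F : OrderedField c ℓ₁ ℓ₂) where
  open OrderedField F

  record Square : Set c where
    constructor sq
    field
      x y : Carrier

  Intersect : Square → Square → Set ℓ₂
  Intersect (sq x₁ y₁) (sq x₂ y₂) =
    (x₁ ≤F x₂ + 1#) × (x₂ ≤F x₁ + 1#) × (y₁ ≤F y₂ + 1#) × (y₂ ≤F y₁ + 1#)

  MeetsLine : Carrier → Square → Set ℓ₂
  MeetsLine h (sq _ y) = (y ≤F h) × (h ≤F y + 1#)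

  record TwoSUIGRep {n} (ε : Carrier) (G : Graph n) : Set (c ⊔ ℓ₂) where
    field
      square : Fin n → Square
      edges  : ∀ u v → Adj G u v ⇔ ((¬ u ≡ v) × Intersect (square u) (square v))
      stab   : ∀ v → MeetsLine 1# (square v) ⊎ MeetsLine (2# + ε) (square v)

-- Put the neighbours of a vertex v into the four closed quadrants around the
-- lower-left corner of v's square.  Two squares that both meet v's square and
-- lie in the same quadrant are at distance at most 1 in each coordinate, so
-- they meet, and their vertices form a triangle with v.  A tree has no
-- triangles, so distinct neighbours occupy distinct quadrants.
module Submission where

open import Defs
open import Data.Nat using (_≤_; suc; s≤s; z≤n)
open import Data.Fin using (Fin)

open import Data.Bool using (Bool; true; false; T)
open import Data.Bool.Properties using (T?)
open import Data.Empty using (⊥-elim)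
open import Data.Product using (_×_; _,_; proj₁; proj₂)
open import Data.Product.Properties using (,-injective)
open import Data.Sum using (_⊎_; inj₁; inj₂; [_,_]′)
open import Data.List using (List; []; _∷_; length; map; filter; allFin; cartesianProduct)
open import Data.List.Properties using (length-map; length-removeAt′)
open import Data.List.Relation.Unary.All as All using (All; []; _∷_)
open import Data.List.Relation.Unary.All.Properties using (all-filter; map⁺)
open import Data.List.Relation.Unary.Any using (here; there; _─_)
open import Data.List.Membership.Propositional using (_∈_)
open import Data.List.Membership.Propositional.Properties using (∈-cartesianProduct⁺)
open import Data.List.Relation.Unary.Unique.Propositional using (Unique; []; _∷_)
import Data.List.Relation.Unary.Unique.Propositional.Properties as Unique
open import Data.Nat.Properties using (≤-refl; module ≤-Reasoning)
open import Function using (const)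
open import Function.Bundles using (Equivalence; _⇔_)
open import Relation.Binary.PropositionalEquality using (_≡_; _≢_; refl; sym; subst)
open import Relation.Binary.Structures using (IsTotalOrder)
open import Relation.Nullary using (¬_)

module _ {a} {A : Set a} where

  ∈-─ : ∀ {x y : A} {ys} (x∈ys : x ∈ ys) → y ∈ ys → x ≢ y → y ∈ (ys ─ x∈ys)
  ∈-─ (here refl)  (here refl)  x≢y = ⊥-elim (x≢y refl)
  ∈-─ (here refl)  (there y∈ys) _   = y∈ys
  ∈-─ (there _)    (here y≡z)   _   = here y≡z
  ∈-─ (there x∈ys) (there y∈ys) x≢y = there (∈-─ x∈ys y∈ys x≢y)

  Unique-length-≤ : ∀ {xs ys : List A} → Unique xs → (∀ {x} → x ∈ xs → x ∈ ys) →
                    length xs ≤ length ys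
  Unique-length-≤ {[]}          _         _     = z≤n
  Unique-length-≤ {x ∷ xs} {ys} (x∉xs ∷ u) xs⊆ys = begin
    suc (length xs)          ≤⟨ s≤s (Unique-length-≤ u xs⊆ys─x) ⟩
    suc (length (ys ─ x∈ys)) ≡⟨ sym (length-removeAt′ ys _) ⟩
    length ys                ∎
    where
    open ≤-Reasoning
    x∈ys : x ∈ ys
    x∈ys = xs⊆ys (here refl)
    xs⊆ys─x : ∀ {y} → y ∈ xs → y ∈ (ys ─ x∈ys)
    xs⊆ys─x y∈xs = ∈-─ x∈ys (xs⊆ys (there y∈xs)) (All.lookup x∉xs y∈xs)

  Unique-map⁺-on : ∀ {b p} {B : Set b} {P : A → Set p} {f : A → B} {xs} →
                   (∀ {x y} → P x → P y → x ≢ y → f x ≢ f y) →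
                   All P xs → Unique xs → Unique (map f xs)
  Unique-map⁺-on _     []         []          = []
  Unique-map⁺-on f-inj (px ∷ pxs) (x∉xs ∷ u) =
    map⁺ (All.zipWith (λ (py , x≢y) → f-inj px py x≢y) (pxs , x∉xs))
      ∷ Unique-map⁺-on f-inj pxs u

booleans : List Bool
booleans = true ∷ false ∷ []

∈-booleans : ∀ b → b ∈ booleans
∈-booleans true  = here refl
∈-booleans false = there (here refl)

Adj-irrefl : ∀ {n} (G : Graph n) {u v} → Adj G u v → u ≢ v
Adj-irrefl G {u} uv refl = subst T (irreflexive G u) uv

Adj-sym : ∀ {n} (G : Graph n) {u v} → Adj G u v → Adj G v u
Adj-sym G {u} {v} = subst T (symmetric G u v)

TriangleFree : ∀ {n} → Graph n → Set
TriangleFree G = ∀ {u v w} → Adj G u v → Adj G u w → ¬ Adj G v w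

acyclic⇒triangle-free : ∀ {n} {G : Graph n} → ¬ Cycle G → TriangleFree G
acyclic⇒triangle-free {G = G} acyclic {u} {v} {w} uv uw vw = acyclic record
  { v₀       = u
  ; vs       = v ∷ w ∷ []
  ; long     = ≤-refl
  ; chain    = uv ∷ vw ∷ [-] w
  ; distinct = (Adj-irrefl G uv ∷ Adj-irrefl G uw ∷ []) ∷ (Adj-irrefl G vw ∷ []) ∷ [] ∷ []
  ; closing  = λ { _ refl → Adj-sym G uw }
  }

module _ {c ℓ₁ ℓ₂} (F : OrderedField c ℓ₁ ℓ₂) where
  open OrderedField F using (Carrier; _≤F_; _+_; 1#; +-mono-≤F; isTotalOrder)
  open IsTotalOrder isTotalOrder using (total; trans)

  close-on-same-side : ∀ {p a b} →
    a ≤F p + 1# → p ≤F a + 1# → b ≤F p + 1# → p ≤F b + 1# →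
    (a ≤F p × b ≤F p) ⊎ (p ≤F a × p ≤F b) → (a ≤F b + 1#) × (b ≤F a + 1#)
  close-on-same-side _ p≤a+1 _ p≤b+1 (inj₁ (a≤p , b≤p)) =
    trans a≤p p≤b+1 , trans b≤p p≤a+1
  close-on-same-side a≤p+1 _ b≤p+1 _ (inj₂ (p≤a , p≤b)) =
    trans a≤p+1 (+-mono-≤F 1# p≤b) , trans b≤p+1 (+-mono-≤F 1# p≤a)

  below : Carrier → Carrier → Bool
  below a p = [ const true , const false ]′ (total a p)

  below-same : ∀ {p a b} → below a p ≡ below b p →
               (a ≤F p × b ≤F p) ⊎ (p ≤F a × p ≤F b)
  below-same {p} {a} {b} _ with total a p | total b p
  ... | inj₁ a≤p | inj₁ b≤p = inj₁ (a≤p , b≤p)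
  ... | inj₂ p≤a | inj₂ p≤b = inj₂ (p≤a , p≤b)

  quadrant : Square F → Square F → Bool × Bool
  quadrant (sq px py) (sq ax ay) = below ax px , below ay py

  Intersect-same-quadrant : ∀ {p s t} → Intersect F p s → Intersect F p t →
    quadrant p s ≡ quadrant p t → Intersect F s t
  Intersect-same-quadrant {sq px py} {sq sx sy} {sq tx ty}
    (px≤ , sx≤ , py≤ , sy≤) (px≤′ , tx≤ , py≤′ , ty≤) same =
    proj₁ x-close , proj₂ x-close , proj₁ y-close , proj₂ y-close
    where
    x-close : (sx ≤F tx + 1#) × (tx ≤F sx + 1#)
    x-close = close-on-same-side sx≤ px≤ tx≤ px≤′ (below-same (proj₁ (,-injective same)))
    y-close : (sy ≤F ty + 1#) × (ty ≤F sy + 1#)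
    y-close = close-on-same-side sy≤ py≤ ty≤ py≤′ (below-same (proj₂ (,-injective same)))

  SquareRepresentation : ∀ {n} → Graph n → (Fin n → Square F) → Set ℓ₂
  SquareRepresentation G square =
    ∀ u v → Adj G u v ⇔ ((¬ u ≡ v) × Intersect F (square u) (square v))

  triangle-free-degree-≤-4 : ∀ {n} (G : Graph n) (square : Fin n → Square F) →
    SquareRepresentation G square → TriangleFree G → ∀ v → degree G v ≤ 4
  triangle-free-degree-≤-4 {n} G square edges triangle-free v = begin
    degree G v                 ≡⟨ sym (length-map q neighbours) ⟩
    length (map q neighbours)  ≤⟨ Unique-length-≤ distinct-quadrants (λ _ → every-quadrant) ⟩
    length (cartesianProduct booleans booleans) ∎
    where
    open ≤-Reasoning
    neighbours : List (Fin n)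
    neighbours = filter (λ w → T? (adj G v w)) (allFin n)

    q : Fin n → Bool × Bool
    q u = quadrant (square v) (square u)

    every-quadrant : ∀ {d} → d ∈ cartesianProduct booleans booleans
    every-quadrant {b , b′} = ∈-cartesianProduct⁺ (∈-booleans b) (∈-booleans b′)

    meets-square-v : ∀ {u} → Adj G v u → Intersect F (square v) (square u)
    meets-square-v {u} vu = proj₂ (Equivalence.to (edges v u) vu)

    separated : ∀ {a b} → Adj G v a → Adj G v b → a ≢ b → q a ≢ q b
    separated {a} {b} va vb a≢b same = triangle-free va vb
      (Equivalence.from (edges a b)
        (a≢b , Intersect-same-quadrant (meets-square-v va) (meets-square-v vb) same))

    distinct-quadrants : Unique (map q neighbours)
    distinct-quadrants = Unique-map⁺-on separated
      (all-filter (λ w → T? (adj G v w)) (allFin n))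
      (Unique.filter⁺ (λ w → T? (adj G v w)) (Unique.allFin⁺ n))

lemma1 : ∀ {c ℓ₁ ℓ₂} (F : OrderedField c ℓ₁ ℓ₂) (ε : OrderedField.Carrier F) → OrderedField._<F_ F (OrderedField.0# F) ε → OrderedField._<F_ F ε (OrderedField.1# F) → ∀ {n} (T : Graph n) → IsTree T → TwoSUIGRep F ε T → ∀ (v : Fin n) → degree T v ≤ 4
lemma1 F ε _ _ G (_ , acyclic) rep =
  triangle-free-degree-≤-4 F G square edges (acyclic⇒triangle-free acyclic)
  where open TwoSUIGRep rep
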